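{- For all $t\in\mathbb N$ and $k\in\mathbb Z$ the sets $A_t(k)$, $B_t(k)$ and $C_t(k)$ are finite unions of arithmetic progressions. Their densities $a_t(k)=\operatorname{dens}A_t(k)$ and $b_t(k)=\operatorname{dens}B_t(k)$ satisfy, for all $t\in\mathbb N$, $k\in\mathbb Z$, \begin{align*} a_{4t}(k)&=\tfrac12\bigl(a_{2t}(k)+b_{2t}(k)\bigr), & b_{4t}(k)&=\tfrac12\bigl(a_{2t}(k)+b_{2t}(k)\bigr),\\ a_{4t+1}(k)&=\tfrac12\bigl(a_{2t}(k)+b_{2t}(k-1)\bigr), & b_{4t+1}(k)&=\tfrac12\bigl(a_{2t+1}(k)+b_{2t+1}(k+1)\bigr),\\ a_{4t+2}(k)&=\tfrac12\bigl(a_{2t+1}(k)+b_{2t+1}(k)\bigr), & b_{4t+2}(k)&=\tfrac12\bigl(a_{2t+1}(k-1)+b_{2t+1}(k+1)\bigr),\\ a_{4t+3}(k)&=\tfrac12\bigl(a_{2t+1}(k-1)+b_{2t+1}(k)\bigr), & b_{4t+3}(k)&=\tfrac12\bigl(a_{2t+2}(k)+b_{2t+2}(k+1)\bigr), \end{align*} with initial conditions $a_0(k)=b_0(k)=1$ if $k=0$ and $0$ otherwise; $a_1(k)=\frac12$ if $k\in\{0,1\}$ and $0$ otherwise; $b_1(k)=0$ if $k>1$, $b_1(1)=\frac14$, and $b_1(k)=3\cdot 2^{k-3}$ if $k<1$.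
   Context: Convention: $0\in\mathbb N$. For $n\in\mathbb N$ with binary expansion $n=\sum_{j\ge0}\delta_j(n)2^j$, let $\mathsf r(n)=\#\{j\ge0:\delta_{j+1}(n)=\delta_j(n)=1\}$, and $d(t,n)=\mathsf r(n+t)-\mathsf r(n)$. For $t\in\mathbb N$, $k\in\mathbb Z$ define $C_t(k)=\{n\in\mathbb N:d(t,n)=k\}$, $A_t(k)=\{n\in\mathbb N:d(t,2n)=k\}$, $B_t(k)=\{n\in\mathbb N:d(t,2n+1)=k\}$. $\operatorname{dens}$ denotes asymptotic density. -}

module Defs where

open import Data.Nat as ℕ using (ℕ; zero; suc; _+_; _*_; _^_; _≤_; _%_)
open import Data.Nat.Properties using (m^n≢0)
open import Data.Integer as ℤ using (ℤ; +_)
open import Data.Rational as ℚ using (ℚ)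
open import Data.List using (List; map; upTo)
open import Data.Nat.ListAction using (sum)
open import Data.List.Relation.Unary.Any using (Any)
open import Data.List.Relation.Unary.All using (All)
open import Data.Product using (_×_; _,_; ∃; ∃-syntax)
open import Data.Bool using (Bool; true; false; if_then_else_)
open import Relation.Nullary using (does)
open import Relation.Unary using (Pred; Decidable)
open import Relation.Binary.PropositionalEquality using (_≡_)
open import Function.Bundles using (_⇔_)
open import Level using (0ℓ)

δ : ℕ → ℕ → ℕ
δ j n = (n ℕ./ (2 ^ j)) {{m^n≢0 2 j}} % 2

blockAt : ℕ → ℕ → ℕ
blockAt n j with δ (suc j) n ℕ.≟ 1 | δ j n ℕ.≟ 1
... | Relation.Nullary.yes _ | Relation.Nullary.yes _ = 1
... | _ | _ = 0

-- r(n) = #{ j ≥ 0 : δ_{j+1}(n) = δ_j(n) = 1 }.  For j ≥ n we have 2^j > n,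
-- hence δ_j(n) = 0, so it suffices to count over j < n.
r : ℕ → ℕ
r n = sum (map (blockAt n) (upTo n))

d : ℕ → ℕ → ℤ
d t n = + r (n + t) ℤ.- + r n

C : ℕ → ℤ → Pred ℕ 0ℓ
C t k n = d t n ≡ k

A : ℕ → ℤ → Pred ℕ 0ℓ
A t k n = d t (2 * n) ≡ k

B : ℕ → ℤ → Pred ℕ 0ℓ
B t k n = d t (2 * n + 1) ≡ k

C? : ∀ t k → Decidable (C t k)
C? t k n = d t n ℤ.≟ k

A? : ∀ t k → Decidable (A t k)
A? t k n = d t (2 * n) ℤ.≟ k

B? : ∀ t k → Decidable (B t k)
B? t k n = d t (2 * n + 1) ℤ.≟ k

InAP : ℕ × ℕ → ℕ → Set
InAP (a , m) n = ∃[ j ] n ≡ a + m * j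

FiniteUnionOfAPs : Pred ℕ 0ℓ → Set
FiniteUnionOfAPs S =
  ∃[ ps ] (All (λ p → 1 ≤ Data.Product.proj₂ p) ps
           × (∀ n → S n ⇔ Any (λ p → InAP p n) ps))

count : {S : Pred ℕ 0ℓ} → Decidable S → ℕ → ℕ
count S? zero = zero
count S? (suc N) = (if does (S? N) then 1 else 0) + count S? N

HasDensity : {S : Pred ℕ 0ℓ} → Decidable S → ℚ → Set
HasDensity S? δ₀ =
  ∀ (ε : ℚ) → ℚ.0ℚ ℚ.< ε →
    ∃[ N₀ ] ∀ N → N₀ ≤ N →
      ℚ.∣ (+ count S? (suc N) ℚ./ suc N) ℚ.- δ₀ ∣ ℚ.< ε

threeOver2^ : ℕ → ℚ
threeOver2^ m = ((+ 3) ℚ./ (2 ^ (m + 3))) {{m^n≢0 2 (m + 3)}}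

module Submission where

-- Since r(2m) = r(m) and r(2m+1) = r(m) + [m odd], the value d(t, n) for t and n of given
-- parities is d(⌊t/2⌋ or ⌈t/2⌉, ⌊n/2⌋) shifted by parity bits.  So the even and the odd
-- elements of A_t(k) and of B_t(k) are copies of sets A_s(k′), B_s(k″) with s < t for t ≥ 2,
-- and C_t(k) is in the same way assembled from A_t(k) and B_t(k).  Such an interleaving of two
-- finite unions of arithmetic progressions is again one, and as its counting function at h is
-- the sum of theirs at ⌈h/2⌉ and ⌊h/2⌋, its density is the mean of theirs.  Strong
-- induction on t concludes, from t = 0 (where d = 0) and t = 1, where B_1(k) is obtained by
-- downward recursion in k from the empty sets B_1(k), k ≥ 2, as d(1, n) ≤ 1.

module BinaryDigits where

  open import Defs
  open import Data.Nat as ℕ using (ℕ; zero; suc; _+_; _*_; _^_; _≤_; _<_; _%_; _/_; z≤n; s≤s; ⌊_/2⌋; ⌈_/2⌉; parity)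
  open import Data.Nat.Properties
  open import Data.Nat.DivMod using (n/1≡n; m/n/o≡m/[n*o]; m<n⇒m/n≡0; [m+n]%n≡m%n; m/n≡1+[m∸n]/n)
  open import Data.Nat.ListAction using (sum)
  open import Data.List using (applyUpTo)
  open import Data.List.Properties using (map-upTo)
  open import Data.Parity.Base using (Parity; 0ℙ; 1ℙ; _⁻¹) renaming (_+_ to _+ℙ_)
  import Data.Parity.Properties as ℙ
  open import Relation.Nullary using (yes; no)
  open import Relation.Binary.PropositionalEquality
  open import Function using (_∘_)

  data EvenOdd : ℕ → Set where
    even : ∀ m → EvenOdd (2 * m)
    odd  : ∀ m → EvenOdd (2 * m + 1)

  evenOdd : ∀ n → EvenOdd n
  evenOdd zero          = even 0
  evenOdd (suc zero)    = odd 0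
  evenOdd (suc (suc n)) with evenOdd n
  ... | even m = subst EvenOdd (*-suc 2 m) (even (suc m))
  ... | odd m  = subst EvenOdd (cong (_+ 1) (*-suc 2 m)) (odd (suc m))

  bit : Parity → ℕ
  bit 0ℙ = 0
  bit 1ℙ = 1

  parity-even : ∀ m → parity (2 * m) ≡ 0ℙ
  parity-even m = ℙ.*-homo-* 2 m

  parity-2*+ : ∀ m n → parity (2 * m + n) ≡ parity n
  parity-2*+ m n = trans (ℙ.+-homo-+ (2 * m) n) (cong (_+ℙ parity n) (parity-even m))

  parity-odd : ∀ m → parity (2 * m + 1) ≡ 1ℙ
  parity-odd m = parity-2*+ m 1

  parity-2*+1+ : ∀ m n → parity (2 * m + 1 + n) ≡ parity n ⁻¹
  parity-2*+1+ m n = trans (ℙ.+-homo-+ (2 * m + 1) n) (cong (_+ℙ parity n) (parity-odd m))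

  ⌊2*n/2⌋≡n : ∀ n → ⌊ 2 * n /2⌋ ≡ n
  ⌊2*n/2⌋≡n zero    = refl
  ⌊2*n/2⌋≡n (suc n) = trans (cong ⌊_/2⌋ (*-suc 2 n)) (cong suc (⌊2*n/2⌋≡n n))

  ⌊2*n+1/2⌋≡n : ∀ n → ⌊ 2 * n + 1 /2⌋ ≡ n
  ⌊2*n+1/2⌋≡n zero    = refl
  ⌊2*n+1/2⌋≡n (suc n) = trans (cong (⌊_/2⌋ ∘ (_+ 1)) (*-suc 2 n)) (cong suc (⌊2*n+1/2⌋≡n n))

  ⌈2*n/2⌉≡n : ∀ n → ⌈ 2 * n /2⌉ ≡ n
  ⌈2*n/2⌉≡n zero    = refl
  ⌈2*n/2⌉≡n (suc n) = trans (cong ⌈_/2⌉ (*-suc 2 n)) (cong suc (⌈2*n/2⌉≡n n))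

  ⌈2*n+1/2⌉≡1+n : ∀ n → ⌈ 2 * n + 1 /2⌉ ≡ suc n
  ⌈2*n+1/2⌉≡1+n zero    = refl
  ⌈2*n+1/2⌉≡1+n (suc n) = trans (cong (⌈_/2⌉ ∘ (_+ 1)) (*-suc 2 n)) (cong suc (⌈2*n+1/2⌉≡1+n n))

  n%2≡bit[parity] : ∀ n → n % 2 ≡ bit (parity n)
  n%2≡bit[parity] zero          = refl
  n%2≡bit[parity] (suc zero)    = refl
  n%2≡bit[parity] (suc (suc n)) = trans (trans (cong (_% 2) (+-comm 2 n)) ([m+n]%n≡m%n n 2)) (n%2≡bit[parity] n)

  n/2≡⌊n/2⌋ : ∀ n → n / 2 ≡ ⌊ n /2⌋
  n/2≡⌊n/2⌋ zero          = refl
  n/2≡⌊n/2⌋ (suc zero)    = refl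
  n/2≡⌊n/2⌋ (suc (suc n)) = trans (m/n≡1+[m∸n]/n {suc (suc n)} {2} (s≤s (s≤s z≤n))) (cong suc (n/2≡⌊n/2⌋ n))

  δ-zero : ∀ n → δ 0 n ≡ bit (parity n)
  δ-zero n = trans (cong (_% 2) (n/1≡n n)) (n%2≡bit[parity] n)

  δ-suc : ∀ j n → δ (suc j) n ≡ δ j ⌊ n /2⌋
  δ-suc j n = trans (cong (_% 2) (sym (m/n/o≡m/[n*o] n 2 (2 ^ j) {{_}} {{m^n≢0 2 j}} {{m^n≢0 2 (suc j)}})))
                    (cong (λ m → (m / 2 ^ j) {{m^n≢0 2 j}} % 2) (n/2≡⌊n/2⌋ n))

  n<2^n : ∀ n → n < 2 ^ n
  n<2^n zero    = s≤s z≤n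
  n<2^n (suc n) = subst (2 + n ≤_) (cong (2 ^ n +_) (sym (+-identityʳ (2 ^ n))))
                        (+-mono-≤ (≤-trans (s≤s z≤n) (n<2^n n)) (n<2^n n))

  δ-beyond : ∀ {j n} → n ≤ j → δ j n ≡ 0
  δ-beyond {j} le = cong (_% 2) (m<n⇒m/n≡0 {{m^n≢0 2 j}} (≤-<-trans le (n<2^n j)))

  bothOne : ℕ → ℕ → ℕ
  bothOne x y with x ℕ.≟ 1 | y ℕ.≟ 1
  ... | yes _ | yes _ = 1
  ... | _     | _     = 0

  blockAt≡bothOne : ∀ n j → blockAt n j ≡ bothOne (δ (suc j) n) (δ j n)
  blockAt≡bothOne n j with δ (suc j) n ℕ.≟ 1 | δ j n ℕ.≟ 1
  ... | yes _ | yes _ = refl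
  ... | yes _ | no _  = refl
  ... | no _  | yes _ = refl
  ... | no _  | no _  = refl

  bothOne-zeroʳ : ∀ x → bothOne x 0 ≡ 0
  bothOne-zeroʳ x with x ℕ.≟ 1
  ... | yes _ = refl
  ... | no _  = refl

  bothOne-bitˡ : ∀ p → bothOne (bit p) 1 ≡ bit p
  bothOne-bitˡ 0ℙ = refl
  bothOne-bitˡ 1ℙ = refl

  blockAt-suc : ∀ n j → blockAt n (suc j) ≡ blockAt ⌊ n /2⌋ j
  blockAt-suc n j = begin
    blockAt n (suc j)                                    ≡⟨ blockAt≡bothOne n (suc j) ⟩
    bothOne (δ (2 + j) n) (δ (suc j) n)                  ≡⟨ cong₂ bothOne (δ-suc (suc j) n) (δ-suc j n) ⟩
    bothOne (δ (suc j) ⌊ n /2⌋) (δ j ⌊ n /2⌋)            ≡⟨ blockAt≡bothOne ⌊ n /2⌋ j ⟨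
    blockAt ⌊ n /2⌋ j                                    ∎
    where open ≡-Reasoning

  blockAt-beyond : ∀ {n j} → n ≤ j → blockAt n j ≡ 0
  blockAt-beyond {n} {j} le = trans (blockAt≡bothOne n j) (trans (cong (bothOne _) (δ-beyond le)) (bothOne-zeroʳ _))

  sum-applyUpTo-cong : ∀ {f g : ℕ → ℕ} → (∀ j → f j ≡ g j) → ∀ L → sum (applyUpTo f L) ≡ sum (applyUpTo g L)
  sum-applyUpTo-cong f≗g zero    = refl
  sum-applyUpTo-cong f≗g (suc L) = cong₂ _+_ (f≗g 0) (sum-applyUpTo-cong (f≗g ∘ suc) L)

  sum-applyUpTo-beyond : ∀ (f : ℕ → ℕ) {L M} → (∀ {j} → L ≤ j → f j ≡ 0) → L ≤ M →
                         sum (applyUpTo f M) ≡ sum (applyUpTo f L)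
  sum-applyUpTo-beyond f {zero}  {zero}  f≡0 _         = refl
  sum-applyUpTo-beyond f {zero}  {suc M} f≡0 _         =
    cong₂ _+_ (f≡0 z≤n) (sum-applyUpTo-beyond (f ∘ suc) (λ _ → f≡0 z≤n) (z≤n {M}))
  sum-applyUpTo-beyond f {suc L} {suc M} f≡0 (s≤s L≤M) =
    cong (f 0 +_) (sum-applyUpTo-beyond (f ∘ suc) (λ le → f≡0 (s≤s le)) L≤M)

  r-⌊/2⌋ : ∀ n → r n ≡ blockAt n 0 + r ⌊ n /2⌋
  r-⌊/2⌋ zero    = refl
  r-⌊/2⌋ (suc n) = begin
    r (suc n)                                              ≡⟨ cong sum (map-upTo (blockAt (suc n)) (suc n)) ⟩
    blockAt (suc n) 0 + sum (applyUpTo (blockAt (suc n) ∘ suc) n)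
      ≡⟨ cong (blockAt (suc n) 0 +_) (sum-applyUpTo-cong (blockAt-suc (suc n)) n) ⟩
    blockAt (suc n) 0 + sum (applyUpTo (blockAt h) n)
      ≡⟨ cong (blockAt (suc n) 0 +_) (sum-applyUpTo-beyond (blockAt h) blockAt-beyond (≤-pred (⌊n/2⌋<n n))) ⟩
    blockAt (suc n) 0 + sum (applyUpTo (blockAt h) h)
      ≡⟨ cong (blockAt (suc n) 0 +_) (cong sum (map-upTo (blockAt h) h)) ⟨
    blockAt (suc n) 0 + r h                                ∎
    where
    h = ⌊ suc n /2⌋
    open ≡-Reasoning

  r-double : ∀ m → r (2 * m) ≡ r m
  r-double m = begin
    r (2 * m)                                          ≡⟨ r-⌊/2⌋ (2 * m) ⟩
    blockAt (2 * m) 0 + r ⌊ 2 * m /2⌋                  ≡⟨ cong₂ _+_ lowBlock (cong r (⌊2*n/2⌋≡n m)) ⟩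
    r m                                                ∎
    where
    open ≡-Reasoning
    lowBlock : blockAt (2 * m) 0 ≡ 0
    lowBlock = trans (blockAt≡bothOne (2 * m) 0)
                     (trans (cong (bothOne _) (trans (δ-zero (2 * m)) (cong bit (parity-even m)))) (bothOne-zeroʳ _))

  r-double+1 : ∀ m → r (2 * m + 1) ≡ bit (parity m) + r m
  r-double+1 m = begin
    r (2 * m + 1)                                      ≡⟨ r-⌊/2⌋ (2 * m + 1) ⟩
    blockAt (2 * m + 1) 0 + r ⌊ 2 * m + 1 /2⌋          ≡⟨ cong₂ _+_ lowBlock (cong r (⌊2*n+1/2⌋≡n m)) ⟩
    bit (parity m) + r m                               ∎
    where
    open ≡-Reasoning
    lowBlock : blockAt (2 * m + 1) 0 ≡ bit (parity m)
    lowBlock = begin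
      blockAt (2 * m + 1) 0                                    ≡⟨ blockAt≡bothOne (2 * m + 1) 0 ⟩
      bothOne (δ 1 (2 * m + 1)) (δ 0 (2 * m + 1))
        ≡⟨ cong₂ bothOne
             (trans (δ-suc 0 (2 * m + 1)) (trans (δ-zero ⌊ 2 * m + 1 /2⌋) (cong (bit ∘ parity) (⌊2*n+1/2⌋≡n m))))
             (trans (δ-zero (2 * m + 1)) (cong bit (parity-odd m))) ⟩
      bothOne (bit (parity m)) 1                               ≡⟨ bothOne-bitˡ (parity m) ⟩
      bit (parity m)                                           ∎

module Differences where

  open import Defs
  open BinaryDigits
  open import Data.Nat using (suc; _+_; _*_; parity)
  open import Data.Nat.Properties using (+-identityʳ; *-distribˡ-+)
  open import Data.Integer as ℤ using (ℤ; +_)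
  import Data.Integer.Properties as ℤP
  open import Relation.Binary.PropositionalEquality
  import Data.Nat.Tactic.RingSolver as ℕ-Ring
  import Data.Integer.Tactic.RingSolver as ℤ-Ring

  d-zero : ∀ n → d 0 n ≡ + 0
  d-zero n = trans (cong (λ m → + r m ℤ.- + r n) (+-identityʳ n)) (ℤP.+-inverseʳ (+ r n))

  d[2t,2n] : ∀ t n → d (2 * t) (2 * n) ≡ d t n
  d[2t,2n] t n = cong₂ (λ x y → + x ℤ.- + y)
    (trans (cong r (sym (*-distribˡ-+ 2 n t))) (r-double (n + t))) (r-double n)

  d[2t,2n+1] : ∀ t n → d (2 * t) (2 * n + 1) ≡ d t n ℤ.+ + bit (parity (n + t)) ℤ.- + bit (parity n)
  d[2t,2n+1] t n = begin
    + r (2 * n + 1 + 2 * t) ℤ.- + r (2 * n + 1)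
      ≡⟨ cong₂ (λ x y → + x ℤ.- + y) (trans (cong r (sum-index n t)) (r-double+1 (n + t))) (r-double+1 n) ⟩
    (+ bit (parity (n + t)) ℤ.+ + r (n + t)) ℤ.- (+ bit (parity n) ℤ.+ + r n)
      ≡⟨ regroup (+ bit (parity (n + t))) (+ r (n + t)) (+ bit (parity n)) (+ r n) ⟩
    d t n ℤ.+ + bit (parity (n + t)) ℤ.- + bit (parity n) ∎
    where
    open ≡-Reasoning
    sum-index : ∀ n t → 2 * n + 1 + 2 * t ≡ 2 * (n + t) + 1
    sum-index = ℕ-Ring.solve-∀
    regroup : ∀ a x b y → (a ℤ.+ x) ℤ.- (b ℤ.+ y) ≡ x ℤ.- y ℤ.+ a ℤ.- b
    regroup = ℤ-Ring.solve-∀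

  d[2t+1,2n] : ∀ t n → d (2 * t + 1) (2 * n) ≡ d t n ℤ.+ + bit (parity (n + t))
  d[2t+1,2n] t n = begin
    + r (2 * n + (2 * t + 1)) ℤ.- + r (2 * n)
      ≡⟨ cong₂ (λ x y → + x ℤ.- + y) (trans (cong r (sum-index n t)) (r-double+1 (n + t))) (r-double n) ⟩
    (+ bit (parity (n + t)) ℤ.+ + r (n + t)) ℤ.- + r n
      ≡⟨ regroup (+ bit (parity (n + t))) (+ r (n + t)) (+ r n) ⟩
    d t n ℤ.+ + bit (parity (n + t)) ∎
    where
    open ≡-Reasoning
    sum-index : ∀ n t → 2 * n + (2 * t + 1) ≡ 2 * (n + t) + 1
    sum-index = ℕ-Ring.solve-∀
    regroup : ∀ a x y → (a ℤ.+ x) ℤ.- y ≡ x ℤ.- y ℤ.+ a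
    regroup = ℤ-Ring.solve-∀

  d[2t+1,2n+1] : ∀ t n → d (2 * t + 1) (2 * n + 1) ≡ d (suc t) n ℤ.- + bit (parity n)
  d[2t+1,2n+1] t n = begin
    + r (2 * n + 1 + (2 * t + 1)) ℤ.- + r (2 * n + 1)
      ≡⟨ cong₂ (λ x y → + x ℤ.- + y) (trans (cong r (sum-index n t)) (r-double (n + suc t))) (r-double+1 n) ⟩
    + r (n + suc t) ℤ.- (+ bit (parity n) ℤ.+ + r n)
      ≡⟨ regroup (+ r (n + suc t)) (+ bit (parity n)) (+ r n) ⟩
    d (suc t) n ℤ.- + bit (parity n) ∎
    where
    open ≡-Reasoning
    sum-index : ∀ n t → 2 * n + 1 + (2 * t + 1) ≡ 2 * (n + suc t)
    sum-index = ℕ-Ring.solve-∀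
    regroup : ∀ x b y → x ℤ.- (b ℤ.+ y) ≡ x ℤ.- y ℤ.- b
    regroup = ℤ-Ring.solve-∀

module Interleavings where

  open import Defs
  open BinaryDigits
  open Differences
  open import Data.Nat using (ℕ; suc; _+_; _*_; parity)
  open import Data.Integer as ℤ using (ℤ; +_; -_)
  import Data.Integer.Properties as ℤP
  import Data.Integer.Tactic.RingSolver as ℤ-Ring
  open import Data.Parity.Base using (Parity; 0ℙ; 1ℙ; _⁻¹)
  open import Data.Product using (_×_; _,_)
  open import Function.Bundles using (_⇔_; mk⇔)
  open import Relation.Binary.PropositionalEquality
  open import Relation.Unary using (Pred)
  open import Level using (0ℓ)
  open import Function using (id)

  Interleaving : Pred ℕ 0ℓ → Pred ℕ 0ℓ → Pred ℕ 0ℓ → Set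
  Interleaving U S T = ∀ m → (U (2 * m) ⇔ S m) × (U (2 * m + 1) ⇔ T m)

  infixl 6 _-ᵖ_ _+ᵖ_

  _-ᵖ_ : ℤ → Parity → ℤ
  k -ᵖ 0ℙ = k
  k -ᵖ 1ℙ = k ℤ.- + 1

  _+ᵖ_ : ℤ → Parity → ℤ
  k +ᵖ 0ℙ = k
  k +ᵖ 1ℙ = k ℤ.+ + 1

  -ᵖ≡-bit : ∀ k p → k ℤ.- + bit p ≡ k -ᵖ p
  -ᵖ≡-bit k 0ℙ = ℤP.+-identityʳ k
  -ᵖ≡-bit k 1ℙ = refl

  +ᵖ≡-[bit⁻¹-1] : ∀ k p → k ℤ.- (+ bit (p ⁻¹) ℤ.- + 1) ≡ k +ᵖ p
  +ᵖ≡-[bit⁻¹-1] k 0ℙ = ℤP.+-identityʳ k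
  +ᵖ≡-[bit⁻¹-1] k 1ℙ = refl

  ≡-transport-⇔ : ∀ {x y k k′ : ℤ} c → y ≡ x ℤ.+ c → k ℤ.- c ≡ k′ → (y ≡ k) ⇔ (x ≡ k′)
  ≡-transport-⇔ {x} {y} {k} c y≡x+c k-c≡k′ = mk⇔
    (λ y≡k → trans (sym (cancel x c)) (trans (cong (ℤ._- c) (trans (sym y≡x+c) y≡k)) k-c≡k′))
    (λ x≡k′ → trans y≡x+c (trans (cong (ℤ._+ c) (trans x≡k′ (sym k-c≡k′))) (uncancel k c)))
    where
    cancel : ∀ x c → x ℤ.+ c ℤ.- c ≡ x
    cancel = ℤ-Ring.solve-∀
    uncancel : ∀ k c → k ℤ.- c ℤ.+ c ≡ k
    uncancel = ℤ-Ring.solve-∀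

  ≡-cong-⇔ : ∀ {x y k : ℤ} → y ≡ x → (y ≡ k) ⇔ (x ≡ k)
  ≡-cong-⇔ y≡x = mk⇔ (trans (sym y≡x)) (trans y≡x)

  A[2t]-interleaving : ∀ t k → Interleaving (A (2 * t) k) (A t k) (B t k)
  A[2t]-interleaving t k m = ≡-cong-⇔ (d[2t,2n] t (2 * m)) , ≡-cong-⇔ (d[2t,2n] t (2 * m + 1))

  B[2t]-interleaving : ∀ t k → Interleaving (B (2 * t) k) (A t (k -ᵖ parity t)) (B t (k +ᵖ parity t))
  B[2t]-interleaving t k m =
    ≡-transport-⇔ (+ bit (parity t)) even-step (-ᵖ≡-bit k (parity t)) ,
    ≡-transport-⇔ (+ bit (parity t ⁻¹) ℤ.- + 1) odd-step (+ᵖ≡-[bit⁻¹-1] k (parity t))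
    where
    even-step : d (2 * t) (2 * (2 * m) + 1) ≡ d t (2 * m) ℤ.+ + bit (parity t)
    even-step = trans (d[2t,2n+1] t (2 * m))
      (trans (cong₂ (λ p q → d t (2 * m) ℤ.+ + bit p ℤ.- + bit q) (parity-2*+ m t) (parity-even m))
             (ℤP.+-identityʳ _))
    odd-step : d (2 * t) (2 * (2 * m + 1) + 1) ≡ d t (2 * m + 1) ℤ.+ (+ bit (parity t ⁻¹) ℤ.- + 1)
    odd-step = trans (d[2t,2n+1] t (2 * m + 1))
      (trans (cong₂ (λ p q → d t (2 * m + 1) ℤ.+ + bit p ℤ.- + bit q) (parity-2*+1+ m t) (parity-odd m))
             (ℤP.+-assoc (d t (2 * m + 1)) _ _))

  A[2t+1]-interleaving : ∀ t k → Interleaving (A (2 * t + 1) k) (A t (k -ᵖ parity t)) (B t (k -ᵖ parity t ⁻¹))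
  A[2t+1]-interleaving t k m =
    ≡-transport-⇔ (+ bit (parity t)) even-step (-ᵖ≡-bit k (parity t)) ,
    ≡-transport-⇔ (+ bit (parity t ⁻¹)) odd-step (-ᵖ≡-bit k (parity t ⁻¹))
    where
    even-step : d (2 * t + 1) (2 * (2 * m)) ≡ d t (2 * m) ℤ.+ + bit (parity t)
    even-step = trans (d[2t+1,2n] t (2 * m)) (cong (λ p → d t (2 * m) ℤ.+ + bit p) (parity-2*+ m t))
    odd-step : d (2 * t + 1) (2 * (2 * m + 1)) ≡ d t (2 * m + 1) ℤ.+ + bit (parity t ⁻¹)
    odd-step = trans (d[2t+1,2n] t (2 * m + 1)) (cong (λ p → d t (2 * m + 1) ℤ.+ + bit p) (parity-2*+1+ m t))

  B[2t+1]-interleaving : ∀ t k → Interleaving (B (2 * t + 1) k) (A (suc t) k) (B (suc t) (k ℤ.+ + 1))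
  B[2t+1]-interleaving t k m =
    ≡-transport-⇔ (+ 0) even-step (ℤP.+-identityʳ k) ,
    ≡-transport-⇔ (- + 1) odd-step refl
    where
    even-step : d (2 * t + 1) (2 * (2 * m) + 1) ≡ d (suc t) (2 * m) ℤ.+ + 0
    even-step = trans (d[2t+1,2n+1] t (2 * m)) (cong (λ p → d (suc t) (2 * m) ℤ.- + bit p) (parity-even m))
    odd-step : d (2 * t + 1) (2 * (2 * m + 1) + 1) ≡ d (suc t) (2 * m + 1) ℤ.+ - + 1
    odd-step = trans (d[2t+1,2n+1] t (2 * m + 1)) (cong (λ p → d (suc t) (2 * m + 1) ℤ.- + bit p) (parity-odd m))

  C-interleaving : ∀ t k → Interleaving (C t k) (A t k) (B t k)
  C-interleaving t k m = mk⇔ id id , mk⇔ id id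

module ArithmeticProgressions where

  open import Defs
  open BinaryDigits using (even; odd; evenOdd)
  open Interleavings using (Interleaving)
  open import Data.Nat using (ℕ; _+_; _*_; _≤_)
  open import Data.Nat.Properties using (*-cancelˡ-≡; +-cancelʳ-≡; even≢odd; +-comm; ≤-trans; m≤m+n)
  import Data.Nat.Tactic.RingSolver as ℕ-Ring
  open import Data.Product using (_×_; _,_; proj₁; proj₂)
  open import Data.Sum using ([_,_]′)
  open import Data.List using (List; map; _++_)
  open import Data.List.Relation.Unary.Any as Any using (Any)
  open import Data.List.Relation.Unary.Any.Properties using (map⁺; map⁻; ++⁺ˡ; ++⁺ʳ; ++⁻)
  open import Data.List.Relation.Unary.All as All using (All)
  open import Data.List.Relation.Unary.All.Properties as All using ()
  open import Data.Empty using (⊥-elim)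
  open import Function using (_∘_; id)
  open import Function.Bundles using (_⇔_; mk⇔; Equivalence)
  import Function.Properties.Equivalence as ⇔
  open import Relation.Binary.PropositionalEquality
  open import Relation.Nullary using (¬_)
  open import Relation.Unary using (Pred)
  open import Level using (0ℓ)

  evenAP oddAP : ℕ × ℕ → ℕ × ℕ
  evenAP (a , m) = 2 * a , 2 * m
  oddAP  (a , m) = 2 * a + 1 , 2 * m

  private
    2*-distrib-AP : ∀ a m j → 2 * (a + m * j) ≡ 2 * a + 2 * m * j
    2*-distrib-AP = ℕ-Ring.solve-∀

    2*+1-distrib-AP : ∀ a m j → 2 * (a + m * j) + 1 ≡ 2 * a + 1 + 2 * m * j
    2*+1-distrib-AP = ℕ-Ring.solve-∀

  InAP-evenAP : ∀ p h → InAP (evenAP p) (2 * h) ⇔ InAP p h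
  InAP-evenAP (a , m) h = mk⇔
    (λ (j , eq) → j , *-cancelˡ-≡ h (a + m * j) 2 (trans eq (sym (2*-distrib-AP a m j))))
    (λ (j , eq) → j , trans (cong (2 *_) eq) (2*-distrib-AP a m j))

  InAP-oddAP : ∀ p h → InAP (oddAP p) (2 * h + 1) ⇔ InAP p h
  InAP-oddAP (a , m) h = mk⇔
    (λ (j , eq) → j , *-cancelˡ-≡ h (a + m * j) 2 (+-cancelʳ-≡ 1 (2 * h) _ (trans eq (sym (2*+1-distrib-AP a m j)))))
    (λ (j , eq) → j , trans (cong (λ x → 2 * x + 1) eq) (2*+1-distrib-AP a m j))

  evenAP-∌-odd : ∀ p h → ¬ InAP (evenAP p) (2 * h + 1)
  evenAP-∌-odd (a , m) h (j , eq) =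
    even≢odd (a + m * j) h (trans (2*-distrib-AP a m j) (trans (sym eq) (+-comm (2 * h) 1)))

  oddAP-∌-even : ∀ p h → ¬ InAP (oddAP p) (2 * h)
  oddAP-∌-even (a , m) h (j , eq) =
    even≢odd h (a + m * j) (trans eq (trans (sym (2*+1-distrib-AP a m j)) (+-comm _ 1)))

  InAny : List (ℕ × ℕ) → ℕ → Set
  InAny ps n = Any (λ p → InAP p n) ps

  InAny-evenAP : ∀ ps h → InAny (map evenAP ps) (2 * h) ⇔ InAny ps h
  InAny-evenAP ps h = mk⇔
    (Any.map (λ {p} → Equivalence.to (InAP-evenAP p h)) ∘ map⁻ {f = evenAP} {P = λ p → InAP p (2 * h)})
    (map⁺ {f = evenAP} {P = λ p → InAP p (2 * h)} ∘ Any.map (λ {p} → Equivalence.from (InAP-evenAP p h)))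

  InAny-oddAP : ∀ ps h → InAny (map oddAP ps) (2 * h + 1) ⇔ InAny ps h
  InAny-oddAP ps h = mk⇔
    (Any.map (λ {p} → Equivalence.to (InAP-oddAP p h)) ∘ map⁻ {f = oddAP} {P = λ p → InAP p (2 * h + 1)})
    (map⁺ {f = oddAP} {P = λ p → InAP p (2 * h + 1)} ∘ Any.map (λ {p} → Equivalence.from (InAP-oddAP p h)))

  InAny-oddAP-∌-even : ∀ qs h → ¬ InAny (map oddAP qs) (2 * h)
  InAny-oddAP-∌-even qs h a with Any.satisfied (map⁻ {f = oddAP} {P = λ p → InAP p (2 * h)} a)
  ... | p , p∋2h = oddAP-∌-even p h p∋2h

  InAny-evenAP-∌-odd : ∀ ps h → ¬ InAny (map evenAP ps) (2 * h + 1)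
  InAny-evenAP-∌-odd ps h a with Any.satisfied (map⁻ {f = evenAP} {P = λ p → InAP p (2 * h + 1)} a)
  ... | p , p∋2h+1 = evenAP-∌-odd p h p∋2h+1

  Any-++-⇔ˡ : ∀ {P : Pred (ℕ × ℕ) 0ℓ} xs {ys} → ¬ Any P ys → Any P (xs ++ ys) ⇔ Any P xs
  Any-++-⇔ˡ xs ¬ys = mk⇔ (λ a → [ id , ⊥-elim ∘ ¬ys ]′ (++⁻ xs a)) ++⁺ˡ

  Any-++-⇔ʳ : ∀ {P : Pred (ℕ × ℕ) 0ℓ} xs {ys} → ¬ Any P xs → Any P (xs ++ ys) ⇔ Any P ys
  Any-++-⇔ʳ xs ¬xs = mk⇔ (λ a → [ ⊥-elim ∘ ¬xs , id ]′ (++⁻ xs a)) (++⁺ʳ xs)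

  Interleaving⇒FiniteUnionOfAPs : ∀ {U S T : Pred ℕ 0ℓ} → Interleaving U S T →
                                  FiniteUnionOfAPs S → FiniteUnionOfAPs T → FiniteUnionOfAPs U
  Interleaving⇒FiniteUnionOfAPs {U} U≋S⋈T (ps , ps>0 , S⇔ps) (qs , qs>0 , T⇔qs) =
    map evenAP ps ++ map oddAP qs ,
    All.++⁺ (All.map⁺ (All.map (λ {p} → double-pos {p}) ps>0))
            (All.map⁺ (All.map (λ {p} → double-pos {p}) qs>0)) ,
    U⇔
    where
    double-pos : ∀ {p} → 1 ≤ proj₂ p → 1 ≤ 2 * proj₂ p
    double-pos {_ , m} 1≤m = ≤-trans 1≤m (m≤m+n m (m + 0))
    U⇔ : ∀ n → U n ⇔ InAny (map evenAP ps ++ map oddAP qs) n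
    U⇔ n with evenOdd n
    ... | even h = ⇔.trans (proj₁ (U≋S⋈T h)) (⇔.trans (S⇔ps h) (⇔.sym
            (⇔.trans (Any-++-⇔ˡ (map evenAP ps) (InAny-oddAP-∌-even qs h)) (InAny-evenAP ps h))))
    ... | odd h  = ⇔.trans (proj₂ (U≋S⋈T h)) (⇔.trans (T⇔qs h) (⇔.sym
            (⇔.trans (Any-++-⇔ʳ (map evenAP ps) (InAny-evenAP-∌-odd ps h)) (InAny-oddAP qs h))))

module AsymptoticDensity where

  open import Defs
  open import Data.Nat as ℕ using (ℕ; zero; suc; z≤n; s≤s; ⌊_/2⌋; ⌈_/2⌉; _⊔_)
  import Data.Nat.Properties as ℕP
  import Data.Integer.Tactic.RingSolver as ℤ-Ring
  open import Data.Integer as ℤ using (ℤ; +_; -[1+_])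
  import Data.Integer.Properties as ℤP
  open import Data.Rational as ℚ
    using (ℚ; mkℚ; 0ℚ; 1ℚ; ½; _+_; _-_; _*_; ∣_∣; _≤_; _<_; *≤*; *<*; ↥_; Positive; NonNegative)
  open import Data.Rational.Literals using (fromℤ)
  import Data.Rational.Properties as ℚP
  open import Data.Rational.Unnormalised as ℚᵘ using (mkℚᵘ; *≡*)
  import Data.Rational.Unnormalised.Properties as ℚᵘP
  open import Data.Rational.Solver using (module +-*-Solver)
  open import Data.Product using (_,_; proj₁; proj₂; ∃-syntax)
  open import Function using (_∘_)
  open import Relation.Unary using (Pred; Decidable)
  open import Relation.Nullary using (does)
  open import Relation.Nullary.Decidable using (does-⇔)
  open import Data.Bool using (if_then_else_)
  open BinaryDigits using (even; odd; evenOdd; ⌊2*n/2⌋≡n; ⌊2*n+1/2⌋≡n; ⌈2*n/2⌉≡n; ⌈2*n+1/2⌉≡1+n)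
  open Interleavings using (Interleaving)
  open import Level using (0ℓ)
  open import Relation.Binary.PropositionalEquality

  toℚ : ℕ → ℚ
  toℚ n = fromℤ (+ n)

  toℚ-homo-+ : ∀ m n → toℚ (m ℕ.+ n) ≡ toℚ m + toℚ n
  toℚ-homo-+ m n = ℚP.toℚᵘ-injective (ℚᵘP.≃-sym (ℚᵘP.≃-trans (ℚP.toℚᵘ-homo-+ (toℚ m) (toℚ n))
    (*≡* (normalise (+ m) (+ n)))))
    where
    normalise : ∀ x y → (x ℤ.* + 1 ℤ.+ y ℤ.* + 1) ℤ.* + 1 ≡ (x ℤ.+ y) ℤ.* + 1
    normalise = ℤ-Ring.solve-∀

  toℚ-mono-≤ : ∀ {m n} → m ℕ.≤ n → toℚ m ≤ toℚ n
  toℚ-mono-≤ {m} {n} m≤n =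
    *≤* (subst₂ ℤ._≤_ (sym (ℤP.*-identityʳ (+ m))) (sym (ℤP.*-identityʳ (+ n))) (ℤ.+≤+ m≤n))

  [c/n]*n≡c : ∀ c N → (+ c ℚ./ suc N) * toℚ (suc N) ≡ toℚ c
  [c/n]*n≡c c N = ℚP.toℚᵘ-injective (ℚᵘP.≃-trans (ℚP.toℚᵘ-homo-* (+ c ℚ./ suc N) (toℚ (suc N)))
    (ℚᵘP.≃-trans (ℚᵘP.*-congʳ (ℚP.toℚᵘ-fromℚᵘ (mkℚᵘ (+ c) N))) (*≡* (normalise (+ c) (+ suc N)))))
    where
    normalise : ∀ x y → x ℤ.* y ℤ.* + 1 ≡ x ℤ.* (y ℤ.* + 1)
    normalise = ℤ-Ring.solve-∀

  p≤toℚ∣↥p∣ : ∀ p → p ≤ toℚ ℤ.∣ ↥ p ∣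
  p≤toℚ∣↥p∣ (mkℚ (+ zero) d _)  = *≤* (ℤ.+≤+ z≤n)
  p≤toℚ∣↥p∣ (mkℚ (+ suc n) d _) = *≤* (ℤ.+≤+ (ℕP.*-monoʳ-≤ (suc n) (s≤s z≤n)))
  p≤toℚ∣↥p∣ (mkℚ -[1+ n ] d _) = *≤* ℤ.-≤+

  archimedean : ∀ C ε → 0ℚ < ε → ∃[ K ] C ≤ ε * toℚ K
  archimedean C ε ε>0 = ℤ.∣ ↥ (C * 1/ε) ∣ , (begin
    C                                     ≡⟨ C≡ε*[C/ε] ⟩
    ε * (C * 1/ε)                         ≤⟨ ℚP.*-monoˡ-≤-nonNeg ε (p≤toℚ∣↥p∣ (C * 1/ε)) ⟩
    ε * toℚ ℤ.∣ ↥ (C * 1/ε) ∣             ∎)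
    where
    open ℚP.≤-Reasoning
    instance
      ε-positive : Positive ε
      ε-positive = ℚ.positive ε>0
      ε-nonNeg : NonNegative ε
      ε-nonNeg = ℚP.pos⇒nonNeg ε
      ε-nonZero : ℚ.NonZero ε
      ε-nonZero = ℚP.pos⇒nonZero ε
    1/ε = ℚ.1/ ε
    C≡ε*[C/ε] : C ≡ ε * (C * 1/ε)
    C≡ε*[C/ε] = sym (trans (ℚP.*-comm ε (C * 1/ε)) (trans (ℚP.*-assoc C 1/ε ε)
                  (trans (cong (C *_) (ℚP.*-inverseˡ ε)) (ℚP.*-identityʳ C))))

  ½*-pos : ∀ {ε} → 0ℚ < ε → 0ℚ < ½ * ε
  ½*-pos {ε} ε>0 = ℚP.positive⁻¹ (½ * ε) {{ℚP.pos*pos⇒pos ½ ε {{ℚ.positive ε>0}}}}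

  ½*<id : ∀ {ε} → 0ℚ < ε → ½ * ε < ε
  ½*<id {ε} ε>0 = subst (½ * ε <_) (ℚP.*-identityˡ ε)
    (ℚP.*-monoˡ-<-pos ε {{ℚ.positive ε>0}} ½<1)
    where
    ½<1 : ½ < 1ℚ
    ½<1 = *<* (ℤ.+<+ (s≤s (s≤s z≤n)))

  ½*+½* : ∀ ε x → ½ * ε * x + ½ * ε * x ≡ ε * x
  ½*+½* = solve 2 (λ ε x → con ½ :* ε :* x :+ con ½ :* ε :* x := ε :* x) refl
    where open +-*-Solver

  Negligible : (ℕ → ℚ) → Set
  Negligible f = ∀ ε → 0ℚ < ε → ∃[ N ] ∀ h → N ℕ.≤ h → ∣ f h ∣ ≤ ε * toℚ h

  Negligible-cong : ∀ {f g} → (∀ h → f h ≡ g h) → Negligible f → Negligible g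
  Negligible-cong {f} {g} f≗g f-negl ε ε>0 with f-negl ε ε>0
  ... | N , bound = N , λ h N≤h → subst (λ x → ∣ x ∣ ≤ ε * toℚ h) (f≗g h) (bound h N≤h)

  Negligible-+ : ∀ {f g} → Negligible f → Negligible g → Negligible (λ h → f h + g h)
  Negligible-+ {f} {g} f-negl g-negl ε ε>0
    with f-negl (½ * ε) (½*-pos ε>0) | g-negl (½ * ε) (½*-pos ε>0)
  ... | N₁ , f-bound | N₂ , g-bound = N₁ ⊔ N₂ , λ h N≤h → begin
    ∣ f h + g h ∣                      ≤⟨ ℚP.∣p+q∣≤∣p∣+∣q∣ (f h) (g h) ⟩
    ∣ f h ∣ + ∣ g h ∣                   ≤⟨ ℚP.+-mono-≤ (f-bound h (ℕP.≤-trans (ℕP.m≤m⊔n N₁ N₂) N≤h))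
                                                      (g-bound h (ℕP.≤-trans (ℕP.m≤n⊔m N₁ N₂) N≤h)) ⟩
    ½ * ε * toℚ h + ½ * ε * toℚ h      ≡⟨ ½*+½* ε (toℚ h) ⟩
    ε * toℚ h                          ∎
    where open ℚP.≤-Reasoning

  Negligible-bounded : ∀ {f} C → (∀ h → ∣ f h ∣ ≤ C) → Negligible f
  Negligible-bounded {f} C bounded ε ε>0 with archimedean C ε ε>0
  ... | K , C≤εK = K , λ h K≤h → begin
    ∣ f h ∣       ≤⟨ bounded h ⟩
    C             ≤⟨ C≤εK ⟩
    ε * toℚ K     ≤⟨ ℚP.*-monoˡ-≤-nonNeg ε {{ℚP.pos⇒nonNeg ε {{ℚ.positive ε>0}}}} (toℚ-mono-≤ K≤h) ⟩
    ε * toℚ h     ∎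
    where open ℚP.≤-Reasoning

  Negligible-∘ : ∀ {f} g → (∀ h → ⌊ h /2⌋ ℕ.≤ g h) → (∀ h → g h ℕ.≤ h) →
                 Negligible f → Negligible (f ∘ g)
  Negligible-∘ {f} g ⌊h/2⌋≤g g≤id f-negl ε ε>0 with f-negl ε ε>0
  ... | N , bound = N ℕ.+ N , λ h 2N≤h → begin
    ∣ f (g h) ∣       ≤⟨ bound (g h) (N≤g h 2N≤h) ⟩
    ε * toℚ (g h)     ≤⟨ ℚP.*-monoˡ-≤-nonNeg ε {{ℚP.pos⇒nonNeg ε {{ℚ.positive ε>0}}}}
                                             (toℚ-mono-≤ (g≤id h)) ⟩
    ε * toℚ h         ∎
    where
    open ℚP.≤-Reasoning
    N≤g : ∀ h → N ℕ.+ N ℕ.≤ h → N ℕ.≤ g h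
    N≤g h 2N≤h =
      ℕP.≤-trans (ℕP.≤-reflexive (ℕP.n≡⌊n+n/2⌋ N)) (ℕP.≤-trans (ℕP.⌊n/2⌋-mono 2N≤h) (⌊h/2⌋≤g h))

  discrepancy : {S : Pred ℕ 0ℓ} → Decidable S → ℚ → ℕ → ℚ
  discrepancy S? δ h = toℚ (count S? h) - δ * toℚ h

  ∣frequency-δ∣*h≡∣discrepancy∣ : ∀ {S : Pred ℕ 0ℓ} (S? : Decidable S) δ N →
    ∣ (+ count S? (suc N) ℚ./ suc N) - δ ∣ * toℚ (suc N) ≡ ∣ discrepancy S? δ (suc N) ∣
  ∣frequency-δ∣*h≡∣discrepancy∣ S? δ N = begin
    ∣ q - δ ∣ * H                ≡⟨ ℚP.∣p*q∣≡∣p∣*∣q∣ (q - δ) H ⟨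
    ∣ (q - δ) * H ∣              ≡⟨ cong ∣_∣ (distrib q δ H) ⟩
    ∣ q * H - δ * H ∣            ≡⟨ cong (λ x → ∣ x - δ * H ∣) ([c/n]*n≡c (count S? (suc N)) N) ⟩
    ∣ discrepancy S? δ (suc N) ∣ ∎
    where
    open ≡-Reasoning
    q = + count S? (suc N) ℚ./ suc N
    H = toℚ (suc N)
    distrib : ∀ q δ H → (q - δ) * H ≡ q * H - δ * H
    distrib = solve 3 (λ q δ H → (q :- δ) :* H := q :* H :- δ :* H) refl
      where open +-*-Solver

  HasDensity⇒Negligible : ∀ {S : Pred ℕ 0ℓ} (S? : Decidable S) {δ} → HasDensity S? δ → Negligible (discrepancy S? δ)
  HasDensity⇒Negligible S? {δ} density ε ε>0 with density ε ε>0
  ... | N₀ , close = suc N₀ , bound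
    where
    bound : ∀ h → suc N₀ ℕ.≤ h → ∣ discrepancy S? δ h ∣ ≤ ε * toℚ h
    bound (suc N) (s≤s N₀≤N) = begin
      ∣ discrepancy S? δ (suc N) ∣                          ≡⟨ ∣frequency-δ∣*h≡∣discrepancy∣ S? δ N ⟨
      ∣ (+ count S? (suc N) ℚ./ suc N) - δ ∣ * toℚ (suc N)
        ≤⟨ ℚP.*-monoʳ-≤-nonNeg (toℚ (suc N)) (ℚP.<⇒≤ (close N N₀≤N)) ⟩
      ε * toℚ (suc N)                                        ∎
      where open ℚP.≤-Reasoning

  Negligible⇒HasDensity : ∀ {S : Pred ℕ 0ℓ} (S? : Decidable S) {δ} → Negligible (discrepancy S? δ) → HasDensity S? δ
  Negligible⇒HasDensity S? {δ} negligible ε ε>0 with negligible (½ * ε) (½*-pos ε>0)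
  ... | N , bound = N , λ M N≤M → ℚP.≤-<-trans (ℚP.*-cancelʳ-≤-pos (toℚ (suc M)) (begin
      ∣ (+ count S? (suc M) ℚ./ suc M) - δ ∣ * toℚ (suc M) ≡⟨ ∣frequency-δ∣*h≡∣discrepancy∣ S? δ M ⟩
      ∣ discrepancy S? δ (suc M) ∣                         ≤⟨ bound (suc M) (ℕP.m≤n⇒m≤1+n N≤M) ⟩
      ½ * ε * toℚ (suc M)                                  ∎)) (½*<id ε>0)
    where open ℚP.≤-Reasoning

  ∣x*[⌈h/2⌉-⌊h/2⌋]∣≤∣x∣ : ∀ x h → ∣ x * (toℚ ⌈ h /2⌉ - toℚ ⌊ h /2⌋) ∣ ≤ ∣ x ∣
  ∣x*[⌈h/2⌉-⌊h/2⌋]∣≤∣x∣ x h with evenOdd h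
  ... | even m =
    ℚP.≤-trans (ℚP.≤-reflexive (cong ∣_∣ (trans (cong (x *_) gap≡0) (ℚP.*-zeroʳ x)))) (ℚP.0≤∣p∣ x)
    where
    gap≡0 : toℚ ⌈ 2 ℕ.* m /2⌉ - toℚ ⌊ 2 ℕ.* m /2⌋ ≡ 0ℚ
    gap≡0 = trans (cong₂ (λ c f → toℚ c - toℚ f) (⌈2*n/2⌉≡n m) (⌊2*n/2⌋≡n m)) (ℚP.+-inverseʳ (toℚ m))
  ... | odd m = ℚP.≤-reflexive (cong ∣_∣ (trans (cong (x *_) gap≡1) (ℚP.*-identityʳ x)))
    where
    gap≡1 : toℚ ⌈ 2 ℕ.* m ℕ.+ 1 /2⌉ - toℚ ⌊ 2 ℕ.* m ℕ.+ 1 /2⌋ ≡ 1ℚ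
    gap≡1 = trans (cong₂ (λ c f → toℚ c - toℚ f) (⌈2*n+1/2⌉≡1+n m) (⌊2*n+1/2⌋≡n m))
                  (trans (cong (_- toℚ m) (toℚ-homo-+ 1 m)) (cancel 1ℚ (toℚ m)))
      where
      cancel : ∀ a b → a + b - b ≡ a
      cancel = solve 2 (λ a b → a :+ b :- b := a) refl
        where open +-*-Solver

  module _ {U S T : Pred ℕ 0ℓ} (U? : Decidable U) (S? : Decidable S) (T? : Decidable T)
           (U≋S⋈T : Interleaving U S T) where

    private
      indicator : {P : Pred ℕ 0ℓ} → Decidable P → ℕ → ℕ
      indicator P? n = if does (P? n) then 1 else 0

      indicator-even : ∀ m → indicator U? (2 ℕ.* m) ≡ indicator S? m
      indicator-even m = cong (λ b → if b then 1 else 0) (does-⇔ (proj₁ (U≋S⋈T m)) (U? (2 ℕ.* m)) (S? m))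

      indicator-odd : ∀ m → indicator U? (2 ℕ.* m ℕ.+ 1) ≡ indicator T? m
      indicator-odd m = cong (λ b → if b then 1 else 0) (does-⇔ (proj₂ (U≋S⋈T m)) (U? (2 ℕ.* m ℕ.+ 1)) (T? m))

    count-interleaving-even : ∀ m → count U? (2 ℕ.* m) ≡ count S? m ℕ.+ count T? m
    count-interleaving-odd  : ∀ m → count U? (2 ℕ.* m ℕ.+ 1) ≡ count S? (suc m) ℕ.+ count T? m
    count-interleaving-even zero    = refl
    count-interleaving-even (suc m) = begin
      count U? (2 ℕ.* suc m)                                  ≡⟨ cong (count U?) (ℕP.*-suc 2 m) ⟩
      indicator U? (suc (2 ℕ.* m)) ℕ.+ count U? (suc (2 ℕ.* m))
        ≡⟨ cong₂ (λ x y → indicator U? x ℕ.+ count U? y) 1+2m≡2m+1 1+2m≡2m+1 ⟩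
      indicator U? (2 ℕ.* m ℕ.+ 1) ℕ.+ count U? (2 ℕ.* m ℕ.+ 1)
        ≡⟨ cong₂ ℕ._+_ (indicator-odd m) (count-interleaving-odd m) ⟩
      indicator T? m ℕ.+ (count S? (suc m) ℕ.+ count T? m)    ≡⟨ ℕP.+-comm (indicator T? m) _ ⟩
      count S? (suc m) ℕ.+ count T? m ℕ.+ indicator T? m      ≡⟨ ℕP.+-assoc (count S? (suc m)) (count T? m) _ ⟩
      count S? (suc m) ℕ.+ (count T? m ℕ.+ indicator T? m)
        ≡⟨ cong (count S? (suc m) ℕ.+_) (ℕP.+-comm (count T? m) _) ⟩
      count S? (suc m) ℕ.+ count T? (suc m)                   ∎
      where
      open ≡-Reasoning
      1+2m≡2m+1 : suc (2 ℕ.* m) ≡ 2 ℕ.* m ℕ.+ 1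
      1+2m≡2m+1 = ℕP.+-comm 1 (2 ℕ.* m)
    count-interleaving-odd m = begin
      count U? (2 ℕ.* m ℕ.+ 1)                           ≡⟨ cong (count U?) (ℕP.+-comm (2 ℕ.* m) 1) ⟩
      indicator U? (2 ℕ.* m) ℕ.+ count U? (2 ℕ.* m)
        ≡⟨ cong₂ ℕ._+_ (indicator-even m) (count-interleaving-even m) ⟩
      indicator S? m ℕ.+ (count S? m ℕ.+ count T? m)      ≡⟨ ℕP.+-assoc (indicator S? m) _ _ ⟨
      count S? (suc m) ℕ.+ count T? m                     ∎
      where open ≡-Reasoning

    count-interleaving : ∀ h → count U? h ≡ count S? ⌈ h /2⌉ ℕ.+ count T? ⌊ h /2⌋
    count-interleaving h with evenOdd h
    ... | even m = trans (count-interleaving-even m)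
                         (sym (cong₂ (λ c f → count S? c ℕ.+ count T? f) (⌈2*n/2⌉≡n m) (⌊2*n/2⌋≡n m)))
    ... | odd m  = trans (count-interleaving-odd m)
                         (sym (cong₂ (λ c f → count S? c ℕ.+ count T? f) (⌈2*n+1/2⌉≡1+n m) (⌊2*n+1/2⌋≡n m)))

    discrepancy-interleaving : ∀ α β h →
      discrepancy S? α ⌈ h /2⌉ + discrepancy T? β ⌊ h /2⌋ + ½ * (α - β) * (toℚ ⌈ h /2⌉ - toℚ ⌊ h /2⌋)
        ≡ discrepancy U? (½ * (α + β)) h
    discrepancy-interleaving α β h = begin
      (σ - α * c) + (τ - β * f) + ½ * (α - β) * (c - f) ≡⟨ regroup σ τ α β c f ⟩
      (σ + τ) - ½ * (α + β) * (f + c)                   ≡⟨ cong₂ (λ x y → x - ½ * (α + β) * y) counts halves ⟩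
      discrepancy U? (½ * (α + β)) h                    ∎
      where
      open ≡-Reasoning
      σ = toℚ (count S? ⌈ h /2⌉)
      τ = toℚ (count T? ⌊ h /2⌋)
      c = toℚ ⌈ h /2⌉
      f = toℚ ⌊ h /2⌋
      counts : σ + τ ≡ toℚ (count U? h)
      counts = trans (sym (toℚ-homo-+ (count S? ⌈ h /2⌉) (count T? ⌊ h /2⌋))) (cong toℚ (sym (count-interleaving h)))
      halves : f + c ≡ toℚ h
      halves = trans (sym (toℚ-homo-+ ⌊ h /2⌋ ⌈ h /2⌉)) (cong toℚ (ℕP.⌊n/2⌋+⌈n/2⌉≡n h))
      regroup : ∀ A B α β c f → (A - α * c) + (B - β * f) + ½ * (α - β) * (c - f) ≡ (A + B) - ½ * (α + β) * (f + c)
      regroup = solve 6 (λ A B α β c f →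
                  (A :- α :* c) :+ (B :- β :* f) :+ con ½ :* (α :- β) :* (c :- f)
                  := (A :+ B) :- con ½ :* (α :+ β) :* (f :+ c)) refl
        where open +-*-Solver

    Interleaving⇒HasDensity : ∀ {α β} → HasDensity S? α → HasDensity T? β → HasDensity U? (½ * (α + β))
    Interleaving⇒HasDensity {α} {β} S-density T-density =
      Negligible⇒HasDensity U? (Negligible-cong (discrepancy-interleaving α β)
        (Negligible-+ (Negligible-+ upper-half lower-half) (Negligible-bounded ∣ ½ * (α - β) ∣ bounded)))
      where
      upper-half : Negligible (discrepancy S? α ∘ ⌈_/2⌉)
      upper-half = Negligible-∘ ⌈_/2⌉ ℕP.⌊n/2⌋≤⌈n/2⌉ ℕP.⌈n/2⌉≤n (HasDensity⇒Negligible S? S-density)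
      lower-half : Negligible (discrepancy T? β ∘ ⌊_/2⌋)
      lower-half = Negligible-∘ ⌊_/2⌋ (λ _ → ℕP.≤-refl) ℕP.⌊n/2⌋≤n (HasDensity⇒Negligible T? T-density)
      bounded : ∀ h → ∣ ½ * (α - β) * (toℚ ⌈ h /2⌉ - toℚ ⌊ h /2⌋) ∣ ≤ ∣ ½ * (α - β) ∣
      bounded = ∣x*[⌈h/2⌉-⌊h/2⌋]∣≤∣x∣ (½ * (α - β))

module InductionScheme where

  open import Defs
  open BinaryDigits
  open Differences
  open Interleavings
  open ArithmeticProgressions
  open AsymptoticDensity
  open import Data.Nat as ℕ using (ℕ; zero; suc; _<_; z≤n; s≤s; parity)
  import Data.Nat.Properties as ℕP
  open import Data.Nat.Induction using (<-rec)
  open import Data.Integer as ℤ using (ℤ; +_; -[1+_])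
  import Data.Integer.Properties as ℤP
  import Data.Rational.Properties as ℚP
  open import Data.Rational.Unnormalised as ℚᵘ using (mkℚᵘ; *≡*)
  import Data.Rational.Unnormalised.Properties as ℚᵘP
  open import Data.Rational as ℚ using (ℚ; 0ℚ; 1ℚ; ½; _+_; _*_)
  open import Data.Parity.Base using (Parity; 0ℙ; 1ℙ; _⁻¹)
  open import Data.Product using (_×_; _,_; proj₁; proj₂)
  open import Data.List using ([]; _∷_)
  open import Data.List.Relation.Unary.Any using (here)
  open import Data.List.Relation.Unary.All using ([]; _∷_)
  open import Data.Empty using (⊥-elim)
  open import Function.Bundles using (mk⇔)
  open import Function using (_∘_)
  open import Relation.Binary.PropositionalEquality
  open import Relation.Nullary using (¬_)
  open import Relation.Nullary.Decidable using (dec-true; dec-false)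
  open import Relation.Unary using (Pred; Decidable)
  open import Level using (0ℓ)

  record APUnionWithDensity {S : Pred ℕ 0ℓ} (S? : Decidable S) (δ : ℚ) : Set where
    constructor _,_
    field
      finiteUnion : FiniteUnionOfAPs S
      density     : HasDensity S? δ

  open APUnionWithDensity public

  Interleaving⇒APUnionWithDensity : ∀ {U S T : Pred ℕ 0ℓ} {U? : Decidable U} {S? : Decidable S} {T? : Decidable T} {α β} →
    Interleaving U S T → APUnionWithDensity S? α → APUnionWithDensity T? β → APUnionWithDensity U? (½ * (α + β))
  Interleaving⇒APUnionWithDensity {U? = U?} {S?} {T?} U≋S⋈T (S-aps , S-density) (T-aps , T-density) =
    Interleaving⇒FiniteUnionOfAPs U≋S⋈T S-aps T-aps , Interleaving⇒HasDensity U? S? T? U≋S⋈T S-density T-density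

  all-APUnionWithDensity : ∀ {S : Pred ℕ 0ℓ} (S? : Decidable S) → (∀ n → S n) → APUnionWithDensity S? 1ℚ
  all-APUnionWithDensity S? all =
    (((0 , 1) ∷ []) , (s≤s z≤n ∷ []) , λ n → mk⇔ (λ _ → here (n , sym (ℕP.*-identityˡ n))) (λ _ → all n)) ,
    Negligible⇒HasDensity S? {1ℚ} (Negligible-bounded 0ℚ (λ h → ℚP.≤-reflexive (cong ℚ.∣_∣ (discrepancy≡0 h))))
    where
    count≡id : ∀ h → count S? h ≡ h
    count≡id zero = refl
    count≡id (suc h) rewrite dec-true (S? h) (all h) = cong suc (count≡id h)
    discrepancy≡0 : ∀ h → discrepancy S? 1ℚ h ≡ 0ℚ
    discrepancy≡0 h rewrite count≡id h | ℚP.*-identityˡ (toℚ h) = ℚP.+-inverseʳ (toℚ h)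

  none-APUnionWithDensity : ∀ {S : Pred ℕ 0ℓ} (S? : Decidable S) → (∀ n → ¬ S n) → APUnionWithDensity S? 0ℚ
  none-APUnionWithDensity S? none =
    ([] , [] , λ n → mk⇔ (⊥-elim ∘ none n) (λ ())) ,
    Negligible⇒HasDensity S? {0ℚ} (Negligible-bounded 0ℚ (λ h → ℚP.≤-reflexive (cong ℚ.∣_∣ (discrepancy≡0 h))))
    where
    count≡0 : ∀ h → count S? h ≡ 0
    count≡0 zero = refl
    count≡0 (suc h) rewrite dec-false (S? h) (none h) = count≡0 h
    discrepancy≡0 : ∀ h → discrepancy S? 0ℚ h ≡ 0ℚ
    discrepancy≡0 h rewrite count≡0 h | ℚP.*-zeroˡ (toℚ h) = refl

  Densities : Set
  Densities = (ℤ → ℚ) × (ℤ → ℚ)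

  DensitiesAt : ℕ → Densities → Set
  DensitiesAt t (α , β) = ∀ k → APUnionWithDensity (A? t k) (α k) × APUnionWithDensity (B? t k) (β k)

  evenStep : Parity → Densities → Densities
  evenStep p (α , β) = (λ k → ½ * (α k + β k)) , (λ k → ½ * (α (k -ᵖ p) + β (k +ᵖ p)))

  oddStep : Parity → Densities → Densities → Densities
  oddStep p (α , β) (α′ , β′) =
    (λ k → ½ * (α (k -ᵖ p) + β (k -ᵖ p ⁻¹))) , (λ k → ½ * (α′ k + β′ (k ℤ.+ + 1)))

  evenStep-DensitiesAt : ∀ t D → DensitiesAt t D → DensitiesAt (2 ℕ.* t) (evenStep (parity t) D)
  evenStep-DensitiesAt t D D-densities k =
    Interleaving⇒APUnionWithDensity (A[2t]-interleaving t k) (proj₁ (D-densities k)) (proj₂ (D-densities k)) ,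
    Interleaving⇒APUnionWithDensity (B[2t]-interleaving t k)
      (proj₁ (D-densities (k -ᵖ parity t))) (proj₂ (D-densities (k +ᵖ parity t)))

  oddStep-DensitiesAt : ∀ t D D′ → DensitiesAt t D → DensitiesAt (suc t) D′ →
                        DensitiesAt (2 ℕ.* t ℕ.+ 1) (oddStep (parity t) D D′)
  oddStep-DensitiesAt t D D′ D-densities D′-densities k =
    Interleaving⇒APUnionWithDensity (A[2t+1]-interleaving t k)
      (proj₁ (D-densities (k -ᵖ parity t))) (proj₂ (D-densities (k -ᵖ parity t ⁻¹))) ,
    Interleaving⇒APUnionWithDensity (B[2t+1]-interleaving t k) (proj₁ (D′-densities k)) (proj₂ (D′-densities (k ℤ.+ + 1)))

  d[1,n]≤1 : ∀ n → d 1 n ℤ.≤ + 1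
  d[1,n]≤1 = <-rec (λ n → d 1 n ℤ.≤ + 1) bound
    where
    bit≤1 : ∀ p → + bit p ℤ.≤ + 1
    bit≤1 0ℙ = ℤ.+≤+ z≤n
    bit≤1 1ℙ = ℤP.≤-refl
    bound : ∀ n → (∀ {m} → m < n → d 1 m ℤ.≤ + 1) → d 1 n ℤ.≤ + 1
    bound n ih with evenOdd n
    ... | even m = subst (ℤ._≤ + 1) (sym (trans (d[2t+1,2n] 0 m) (cong (ℤ._+ + bit (parity (m ℕ.+ 0))) (d-zero m))))
                     (bit≤1 (parity (m ℕ.+ 0)))
    ... | odd m  = subst (ℤ._≤ + 1) (sym (d[2t+1,2n+1] 0 m))
                     (ℤP.≤-trans (ℤP.i-j≤i (d 1 m) (+ bit (parity m))) (ih m<2m+1))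
      where
      m<2m+1 : m < 2 ℕ.* m ℕ.+ 1
      m<2m+1 = ℕP.≤-trans (ℕP.m≤m+n (suc m) (m ℕ.+ 0)) (ℕP.≤-reflexive (ℕP.+-comm 1 (2 ℕ.* m)))

  a₀ : ℤ → ℚ
  a₀ (+ zero)  = 1ℚ
  a₀ (+ suc _) = 0ℚ
  a₀ -[1+ _ ]  = 0ℚ

  a₁ : ℤ → ℚ
  a₁ (+ zero)        = ½
  a₁ (+ suc zero)    = ½
  a₁ (+ suc (suc _)) = 0ℚ
  a₁ -[1+ _ ]        = 0ℚ

  b₁ : ℤ → ℚ
  b₁ (+ zero)        = threeOver2^ 0
  b₁ (+ suc zero)    = ½ * ½
  b₁ (+ suc (suc _)) = 0ℚ
  b₁ -[1+ m ]        = threeOver2^ (suc m)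

  threeOver2^-suc : ∀ m → threeOver2^ (suc m) ≡ ½ * (0ℚ + threeOver2^ m)
  threeOver2^-suc m = ℚP.toℚᵘ-injective (begin
    ℚ.toℚᵘ (threeOver2^ (suc m))                       ≈⟨ toℚᵘ-/ (+ 3) (2 ℕ.* D) ⟩
    + 3 ℚᵘ./ (2 ℕ.* D)                                 ≈⟨ halve D ⟨
    ℚᵘ.½ ℚᵘ.* (ℚᵘ.0ℚᵘ ℚᵘ.+ + 3 ℚᵘ./ D)
      ≈⟨ ℚᵘP.*-congˡ {ℚᵘ.½} (ℚᵘP.+-congʳ ℚᵘ.0ℚᵘ (toℚᵘ-/ (+ 3) D)) ⟨
    ℚᵘ.½ ℚᵘ.* (ℚᵘ.0ℚᵘ ℚᵘ.+ ℚ.toℚᵘ (threeOver2^ m))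
      ≈⟨ ℚᵘP.*-congˡ {ℚᵘ.½} (ℚP.toℚᵘ-homo-+ 0ℚ (threeOver2^ m)) ⟨
    ℚᵘ.½ ℚᵘ.* ℚ.toℚᵘ (0ℚ + threeOver2^ m)               ≈⟨ ℚP.toℚᵘ-homo-* ½ (0ℚ + threeOver2^ m) ⟨
    ℚ.toℚᵘ (½ * (0ℚ + threeOver2^ m))                   ∎)
    where
    open ℚᵘP.≃-Reasoning
    D = 2 ℕ.^ (m ℕ.+ 3)
    instance
      D≢0 : ℕ.NonZero D
      D≢0 = ℕP.m^n≢0 2 (m ℕ.+ 3)
      2D≢0 : ℕ.NonZero (2 ℕ.* D)
      2D≢0 = ℕP.m^n≢0 2 (suc m ℕ.+ 3)
    toℚᵘ-/ : ∀ z d .{{_ : ℕ.NonZero d}} → ℚ.toℚᵘ (z ℚ./ d) ℚᵘ.≃ z ℚᵘ./ d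
    toℚᵘ-/ z (suc d) = ℚP.toℚᵘ-fromℚᵘ (mkℚᵘ z d)
    halve : ∀ d .{{_ : ℕ.NonZero d}} .{{_ : ℕ.NonZero (2 ℕ.* d)}} →
            ℚᵘ.½ ℚᵘ.* (ℚᵘ.0ℚᵘ ℚᵘ.+ + 3 ℚᵘ./ d) ℚᵘ.≃ + 3 ℚᵘ./ (2 ℕ.* d)
    halve (suc d) = *≡* (cong (λ x → + 3 ℤ.* + (2 ℕ.* suc x)) (sym (ℕP.+-identityʳ d)))

  a₀-fixed : ∀ k → a₀ k ≡ ½ * (a₀ k + a₀ k)
  a₀-fixed (+ zero)  = refl
  a₀-fixed (+ suc _) = refl
  a₀-fixed -[1+ _ ]  = refl

  a₁-recurrence : ∀ k → a₁ k ≡ ½ * (a₀ k + a₀ (k ℤ.- + 1))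
  a₁-recurrence (+ zero)        = refl
  a₁-recurrence (+ suc zero)    = refl
  a₁-recurrence (+ suc (suc _)) = refl
  a₁-recurrence -[1+ _ ]        = refl

  b₁-recurrence : ∀ k → b₁ k ≡ ½ * (a₁ k + b₁ (k ℤ.+ + 1))
  b₁-recurrence (+ zero)        = refl
  b₁-recurrence (+ suc zero)    = refl
  b₁-recurrence (+ suc (suc _)) = refl
  b₁-recurrence -[1+ zero ]     = threeOver2^-suc 0
  b₁-recurrence -[1+ suc m ]    = threeOver2^-suc (suc m)

  densitiesAt-0-≢0 : ∀ {k} → + 0 ≢ k → APUnionWithDensity (A? 0 k) 0ℚ × APUnionWithDensity (B? 0 k) 0ℚ
  densitiesAt-0-≢0 0≢k = none-APUnionWithDensity _ (λ n → 0≢k ∘ trans (sym (d-zero (2 ℕ.* n)))) ,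
                         none-APUnionWithDensity _ (λ n → 0≢k ∘ trans (sym (d-zero (2 ℕ.* n ℕ.+ 1))))

  densitiesAt-0 : DensitiesAt 0 (a₀ , a₀)
  densitiesAt-0 (+ zero)  = all-APUnionWithDensity _ (d-zero ∘ (2 ℕ.*_)) ,
                            all-APUnionWithDensity _ (λ n → d-zero (2 ℕ.* n ℕ.+ 1))
  densitiesAt-0 (+ suc _) = densitiesAt-0-≢0 λ ()
  densitiesAt-0 -[1+ _ ]  = densitiesAt-0-≢0 λ ()

  densitiesAt-1 : DensitiesAt 1 (a₁ , b₁)
  densitiesAt-1 k = A₁-structure k , B₁-structure k
    where
    A₁-structure : ∀ k → APUnionWithDensity (A? 1 k) (a₁ k)
    A₁-structure k = subst (APUnionWithDensity (A? 1 k)) (sym (a₁-recurrence k))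
      (Interleaving⇒APUnionWithDensity (A[2t+1]-interleaving 0 k)
        (proj₁ (densitiesAt-0 k)) (proj₂ (densitiesAt-0 (k ℤ.- + 1))))
    B₁-step : ∀ k → APUnionWithDensity (B? 1 (k ℤ.+ + 1)) (b₁ (k ℤ.+ + 1)) → APUnionWithDensity (B? 1 k) (b₁ k)
    B₁-step k B[k+1] = subst (APUnionWithDensity (B? 1 k)) (sym (b₁-recurrence k))
      (Interleaving⇒APUnionWithDensity (B[2t+1]-interleaving 0 k) (A₁-structure k) B[k+1])
    B₁-structure-≥2 : ∀ m → APUnionWithDensity (B? 1 (+ suc (suc m))) (b₁ (+ suc (suc m)))
    B₁-structure-≥2 m =
      none-APUnionWithDensity _ λ n d≡k → 2+m≰1 (subst (ℤ._≤ + 1) d≡k (d[1,n]≤1 (2 ℕ.* n ℕ.+ 1)))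
      where
      2+m≰1 : ¬ (+ suc (suc m) ℤ.≤ + 1)
      2+m≰1 (ℤ.+≤+ (s≤s ()))
    B₁-structure-≥0 : ∀ n → APUnionWithDensity (B? 1 (+ n)) (b₁ (+ n))
    B₁-structure-≥0 zero          = B₁-step (+ 0) (B₁-step (+ 1) (B₁-structure-≥2 0))
    B₁-structure-≥0 (suc zero)    = B₁-step (+ 1) (B₁-structure-≥2 0)
    B₁-structure-≥0 (suc (suc m)) = B₁-structure-≥2 m
    B₁-structure-<0 : ∀ m → APUnionWithDensity (B? 1 -[1+ m ]) (b₁ -[1+ m ])
    B₁-structure-<0 zero    = B₁-step -[1+ 0 ] (B₁-structure-≥0 0)
    B₁-structure-<0 (suc m) = B₁-step -[1+ suc m ] (B₁-structure-<0 m)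
    B₁-structure : ∀ k → APUnionWithDensity (B? 1 k) (b₁ k)
    B₁-structure (+ n)      = B₁-structure-≥0 n
    B₁-structure -[1+ m ]   = B₁-structure-<0 m

module DensitySequence where

  open BinaryDigits
  open Interleavings using (_-ᵖ_; _+ᵖ_)
  open InductionScheme
  open import Data.Nat as ℕ using (ℕ; zero; suc; _≤_; _<_; z≤n; s≤s; ⌊_/2⌋; parity)
  import Data.Nat.Properties as ℕP
  open import Data.Nat.Induction using (<-rec)
  import Data.Nat.Tactic.RingSolver as ℕ-Ring
  open import Data.Integer as ℤ using (ℤ; +_)
  open import Data.Rational using (ℚ; ½; _+_; _*_)
  open import Data.Parity.Base using (Parity; 0ℙ; 1ℙ; _⁻¹)
  open import Data.Product using (_,_; proj₁; proj₂)
  open import Function using (_∘_)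
  open import Relation.Binary.PropositionalEquality

  fromHalf : Parity → ℕ → (ℕ → Densities) → Densities
  fromHalf 0ℙ s D = evenStep (parity s) (D s)
  fromHalf 1ℙ s D = oddStep (parity s) (D s) (D (suc s))

  -- The first argument is fuel bounding the recursion depth; n + 2 = 2 (⌊ n /2⌋ + 1) + [n odd].
  densitiesWithin : ℕ → ℕ → Densities
  densitiesWithin zero    _             = a₀ , a₀
  densitiesWithin (suc _) zero          = a₀ , a₀
  densitiesWithin (suc _) (suc zero)    = a₁ , b₁
  densitiesWithin (suc f) (suc (suc n)) = fromHalf (parity n) (suc ⌊ n /2⌋) (densitiesWithin f)

  odd⇒⌊n/2⌋<n : ∀ {n} → parity n ≡ 1ℙ → ⌊ n /2⌋ < n
  odd⇒⌊n/2⌋<n {zero}        ()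
  odd⇒⌊n/2⌋<n {suc zero}    _     = s≤s z≤n
  odd⇒⌊n/2⌋<n {suc (suc n)} n-odd = s≤s (ℕP.m≤n⇒m≤1+n (odd⇒⌊n/2⌋<n n-odd))

  densitiesWithin-irrelevant : ∀ {f f′} n → n ≤ f → n ≤ f′ → densitiesWithin f n ≡ densitiesWithin f′ n
  densitiesWithin-irrelevant {zero}  {zero}   zero _ _ = refl
  densitiesWithin-irrelevant {zero}  {suc _}  zero _ _ = refl
  densitiesWithin-irrelevant {suc _} {zero}   zero _ _ = refl
  densitiesWithin-irrelevant {suc _} {suc _}  zero _ _ = refl
  densitiesWithin-irrelevant {suc _} {suc _}  (suc zero) _ _ = refl
  densitiesWithin-irrelevant {suc f} {suc f′} (suc (suc n)) (s≤s n+1≤f) (s≤s n+1≤f′) with parity n in eq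
  ... | 0ℙ = cong (evenStep (parity (suc ⌊ n /2⌋)))
                  (densitiesWithin-irrelevant (suc ⌊ n /2⌋) (half≤ n+1≤f) (half≤ n+1≤f′))
    where
    half≤ : ∀ {g} → suc n ≤ g → suc ⌊ n /2⌋ ≤ g
    half≤ = ℕP.≤-trans (s≤s (ℕP.⌊n/2⌋≤n n))
  ... | 1ℙ = cong₂ (oddStep (parity (suc ⌊ n /2⌋)))
                   (densitiesWithin-irrelevant (suc ⌊ n /2⌋) (half≤ n+1≤f) (half≤ n+1≤f′))
                   (densitiesWithin-irrelevant (suc (suc ⌊ n /2⌋)) (half+1≤ n+1≤f) (half+1≤ n+1≤f′))
    where
    half+1≤ : ∀ {g} → suc n ≤ g → suc (suc ⌊ n /2⌋) ≤ g
    half+1≤ = ℕP.≤-trans (s≤s (odd⇒⌊n/2⌋<n eq))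
    half≤ : ∀ {g} → suc n ≤ g → suc ⌊ n /2⌋ ≤ g
    half≤ = ℕP.≤-trans (ℕP.n≤1+n _) ∘ half+1≤

  densities : ℕ → Densities
  densities n = densitiesWithin n n

  densities-suc-suc : ∀ n → densities (suc (suc n)) ≡ fromHalf (parity n) (suc ⌊ n /2⌋) densities
  densities-suc-suc n with parity n in eq
  ... | 0ℙ = cong (evenStep (parity (suc ⌊ n /2⌋)))
                  (densitiesWithin-irrelevant (suc ⌊ n /2⌋) (s≤s (ℕP.⌊n/2⌋≤n n)) ℕP.≤-refl)
  ... | 1ℙ = cong₂ (oddStep (parity (suc ⌊ n /2⌋)))
                   (densitiesWithin-irrelevant (suc ⌊ n /2⌋) (ℕP.≤-trans (ℕP.n≤1+n _) half+1≤) ℕP.≤-refl)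
                   (densitiesWithin-irrelevant (suc (suc ⌊ n /2⌋)) half+1≤ ℕP.≤-refl)
    where
    half+1≤ : suc (suc ⌊ n /2⌋) ≤ suc n
    half+1≤ = s≤s (odd⇒⌊n/2⌋<n eq)

  densities-double : ∀ s .{{_ : ℕ.NonZero s}} → densities (2 ℕ.* s) ≡ evenStep (parity s) (densities s)
  densities-double (suc t) = begin
    densities (2 ℕ.* suc t)                                  ≡⟨ cong densities (ℕP.*-suc 2 t) ⟩
    densities (2 ℕ.+ 2 ℕ.* t)                                ≡⟨ densities-suc-suc (2 ℕ.* t) ⟩
    fromHalf (parity (2 ℕ.* t)) (suc ⌊ 2 ℕ.* t /2⌋) densities
      ≡⟨ cong₂ (λ p s → fromHalf p (suc s) densities) (parity-even t) (⌊2*n/2⌋≡n t) ⟩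
    evenStep (parity (suc t)) (densities (suc t))            ∎
    where open ≡-Reasoning

  densities-double+1 : ∀ s .{{_ : ℕ.NonZero s}} →
                       densities (2 ℕ.* s ℕ.+ 1) ≡ oddStep (parity s) (densities s) (densities (suc s))
  densities-double+1 (suc t) = begin
    densities (2 ℕ.* suc t ℕ.+ 1)                            ≡⟨ cong (densities ∘ (ℕ._+ 1)) (ℕP.*-suc 2 t) ⟩
    densities (2 ℕ.+ (2 ℕ.* t ℕ.+ 1))                        ≡⟨ densities-suc-suc (2 ℕ.* t ℕ.+ 1) ⟩
    fromHalf (parity (2 ℕ.* t ℕ.+ 1)) (suc ⌊ 2 ℕ.* t ℕ.+ 1 /2⌋) densities
      ≡⟨ cong₂ (λ p s → fromHalf p (suc s) densities) (parity-odd t) (⌊2*n+1/2⌋≡n t) ⟩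
    oddStep (parity (suc t)) (densities (suc t)) (densities (2 ℕ.+ t)) ∎
    where open ≡-Reasoning

  densities-correct : ∀ t → DensitiesAt t (densities t)
  densities-correct = <-rec (λ t → DensitiesAt t (densities t)) step
    where
    step : ∀ t → (∀ {s} → s < t → DensitiesAt s (densities s)) → DensitiesAt t (densities t)
    step t ih with evenOdd t
    ... | even zero    = densitiesAt-0
    ... | odd zero     = densitiesAt-1
    ... | even (suc s) = subst (DensitiesAt (2 ℕ.* suc s)) (sym (densities-double (suc s)))
                           (evenStep-DensitiesAt (suc s) _ (ih 1+s<2[1+s]))
      where
      1+s<2[1+s] : suc s < 2 ℕ.* suc s
      1+s<2[1+s] = ℕP.≤-trans (s≤s (s≤s (ℕP.m≤m+n s (s ℕ.+ 0)))) (ℕP.≤-reflexive (sym (ℕP.*-suc 2 s)))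
    ... | odd (suc s)  = subst (DensitiesAt (2 ℕ.* suc s ℕ.+ 1)) (sym (densities-double+1 (suc s)))
                           (oddStep-DensitiesAt (suc s) _ _ (ih (ℕP.<-trans (ℕP.n<1+n (suc s)) 2+s<2[1+s]+1)) (ih 2+s<2[1+s]+1))
      where
      2+s<2[1+s]+1 : 2 ℕ.+ s < 2 ℕ.* suc s ℕ.+ 1
      2+s<2[1+s]+1 = ℕP.≤-trans (ℕP.+-monoʳ-≤ 3 (ℕP.m≤m+n s (s ℕ.+ 0))) (ℕP.≤-reflexive (reindex s))
        where
        reindex : ∀ s → 3 ℕ.+ 2 ℕ.* s ≡ 2 ℕ.* suc s ℕ.+ 1
        reindex = ℕ-Ring.solve-∀

  a b : ℕ → ℤ → ℚ
  a t = proj₁ (densities t)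
  b t = proj₂ (densities t)

  a-double : ∀ s .{{_ : ℕ.NonZero s}} k → a (2 ℕ.* s) k ≡ ½ * (a s k + b s k)
  a-double s k = cong (λ D → proj₁ D k) (densities-double s)

  b-double : ∀ s .{{_ : ℕ.NonZero s}} k → b (2 ℕ.* s) k ≡ ½ * (a s (k -ᵖ parity s) + b s (k +ᵖ parity s))
  b-double s k = cong (λ D → proj₂ D k) (densities-double s)

  a-double+1 : ∀ s .{{_ : ℕ.NonZero s}} k →
               a (2 ℕ.* s ℕ.+ 1) k ≡ ½ * (a s (k -ᵖ parity s) + b s (k -ᵖ parity s ⁻¹))
  a-double+1 s k = cong (λ D → proj₁ D k) (densities-double+1 s)

  b-double+1 : ∀ s .{{_ : ℕ.NonZero s}} k → b (2 ℕ.* s ℕ.+ 1) k ≡ ½ * (a (suc s) k + b (suc s) (k ℤ.+ + 1))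
  b-double+1 s k = cong (λ D → proj₂ D k) (densities-double+1 s)

  private
    4t≡2[2t] : ∀ t → 4 ℕ.* t ≡ 2 ℕ.* (2 ℕ.* t)
    4t≡2[2t] = ℕ-Ring.solve-∀
    4t+1≡2[2t]+1 : ∀ t → 4 ℕ.* t ℕ.+ 1 ≡ 2 ℕ.* (2 ℕ.* t) ℕ.+ 1
    4t+1≡2[2t]+1 = ℕ-Ring.solve-∀
    4t+2≡2[2t+1] : ∀ t → 4 ℕ.* t ℕ.+ 2 ≡ 2 ℕ.* (2 ℕ.* t ℕ.+ 1)
    4t+2≡2[2t+1] = ℕ-Ring.solve-∀
    4t+3≡2[2t+1]+1 : ∀ t → 4 ℕ.* t ℕ.+ 3 ≡ 2 ℕ.* (2 ℕ.* t ℕ.+ 1) ℕ.+ 1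
    4t+3≡2[2t+1]+1 = ℕ-Ring.solve-∀
    2t+1≢0 : ∀ t → ℕ.NonZero (2 ℕ.* t ℕ.+ 1)
    2t+1≢0 t = ℕ.≢-nonZero (ℕP.m+1+n≢0 (2 ℕ.* t))

  a[4t] : ∀ t k → a (4 ℕ.* t) k ≡ ½ * (a (2 ℕ.* t) k + b (2 ℕ.* t) k)
  a[4t] zero    k = a₀-fixed k
  a[4t] (suc t) k = trans (cong (λ n → a n k) (4t≡2[2t] (suc t))) (a-double (2 ℕ.* suc t) k)

  b[4t] : ∀ t k → b (4 ℕ.* t) k ≡ ½ * (a (2 ℕ.* t) k + b (2 ℕ.* t) k)
  b[4t] zero    k = a₀-fixed k
  b[4t] (suc t) k = trans (cong (λ n → b n k) (4t≡2[2t] (suc t))) (trans (b-double (2 ℕ.* suc t) k)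
    (cong (λ p → ½ * (a (2 ℕ.* suc t) (k -ᵖ p) + b (2 ℕ.* suc t) (k +ᵖ p))) (parity-even (suc t))))

  a[4t+1] : ∀ t k → a (4 ℕ.* t ℕ.+ 1) k ≡ ½ * (a (2 ℕ.* t) k + b (2 ℕ.* t) (k ℤ.- + 1))
  a[4t+1] zero    k = a₁-recurrence k
  a[4t+1] (suc t) k = trans (cong (λ n → a n k) (4t+1≡2[2t]+1 (suc t))) (trans (a-double+1 (2 ℕ.* suc t) k)
    (cong (λ p → ½ * (a (2 ℕ.* suc t) (k -ᵖ p) + b (2 ℕ.* suc t) (k -ᵖ p ⁻¹))) (parity-even (suc t))))

  b[4t+1] : ∀ t k → b (4 ℕ.* t ℕ.+ 1) k ≡ ½ * (a (2 ℕ.* t ℕ.+ 1) k + b (2 ℕ.* t ℕ.+ 1) (k ℤ.+ + 1))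
  b[4t+1] zero    k = b₁-recurrence k
  b[4t+1] (suc t) k = trans (cong (λ n → b n k) (4t+1≡2[2t]+1 (suc t))) (trans (b-double+1 (2 ℕ.* suc t) k)
    (cong (λ n → ½ * (a n k + b n (k ℤ.+ + 1))) (ℕP.+-comm 1 (2 ℕ.* suc t))))

  a[4t+2] : ∀ t k → a (4 ℕ.* t ℕ.+ 2) k ≡ ½ * (a (2 ℕ.* t ℕ.+ 1) k + b (2 ℕ.* t ℕ.+ 1) k)
  a[4t+2] t k = trans (cong (λ n → a n k) (4t+2≡2[2t+1] t)) (a-double (2 ℕ.* t ℕ.+ 1) {{2t+1≢0 t}} k)

  b[4t+2] : ∀ t k → b (4 ℕ.* t ℕ.+ 2) k ≡ ½ * (a (2 ℕ.* t ℕ.+ 1) (k ℤ.- + 1) + b (2 ℕ.* t ℕ.+ 1) (k ℤ.+ + 1))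
  b[4t+2] t k = trans (cong (λ n → b n k) (4t+2≡2[2t+1] t)) (trans (b-double (2 ℕ.* t ℕ.+ 1) {{2t+1≢0 t}} k)
    (cong (λ p → ½ * (a (2 ℕ.* t ℕ.+ 1) (k -ᵖ p) + b (2 ℕ.* t ℕ.+ 1) (k +ᵖ p))) (parity-odd t)))

  a[4t+3] : ∀ t k → a (4 ℕ.* t ℕ.+ 3) k ≡ ½ * (a (2 ℕ.* t ℕ.+ 1) (k ℤ.- + 1) + b (2 ℕ.* t ℕ.+ 1) k)
  a[4t+3] t k = trans (cong (λ n → a n k) (4t+3≡2[2t+1]+1 t)) (trans (a-double+1 (2 ℕ.* t ℕ.+ 1) {{2t+1≢0 t}} k)
    (cong (λ p → ½ * (a (2 ℕ.* t ℕ.+ 1) (k -ᵖ p) + b (2 ℕ.* t ℕ.+ 1) (k -ᵖ p ⁻¹))) (parity-odd t)))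

  b[4t+3] : ∀ t k → b (4 ℕ.* t ℕ.+ 3) k ≡ ½ * (a (2 ℕ.* t ℕ.+ 2) k + b (2 ℕ.* t ℕ.+ 2) (k ℤ.+ + 1))
  b[4t+3] t k = trans (cong (λ n → b n k) (4t+3≡2[2t+1]+1 t)) (trans (b-double+1 (2 ℕ.* t ℕ.+ 1) {{2t+1≢0 t}} k)
    (cong (λ n → ½ * (a n k + b n (k ℤ.+ + 1))) (trans (ℕP.+-comm 1 (2 ℕ.* t ℕ.+ 1)) (ℕP.+-assoc (2 ℕ.* t) 1 1))))

open import Defs
open import Data.Nat using (ℕ; suc; _+_; _*_)
open import Data.Integer using (ℤ; +_; -_; -[1+_]; _-_) renaming (_+_ to _+ℤ_)
open import Data.Rational using (ℚ; 0ℚ; ½; 1ℚ) renaming (_*_ to _*ℚ_; _+_ to _+ℚ_)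
open import Data.Product using (_×_; Σ; _,_; proj₁; proj₂)
open import Relation.Binary.PropositionalEquality using (_≡_; refl)
open import Data.Nat using (zero)
open Interleavings using (C-interleaving)
open ArithmeticProgressions using (Interleaving⇒FiniteUnionOfAPs)
open InductionScheme using (finiteUnion; density)
open DensitySequence using (densities-correct; a[4t]; b[4t]; a[4t+1]; b[4t+1]; a[4t+2]; b[4t+2]; a[4t+3]; b[4t+3])

proposition3p2 :
    (∀ (t : ℕ) (k : ℤ) →
        FiniteUnionOfAPs (A t k) × FiniteUnionOfAPs (B t k) × FiniteUnionOfAPs (C t k))
    ×
    Σ (ℕ → ℤ → ℚ) λ a → Σ (ℕ → ℤ → ℚ) λ b →
      ( (∀ (t : ℕ) (k : ℤ) → HasDensity (A? t k) (a t k) × HasDensity (B? t k) (b t k))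
      × (∀ (t : ℕ) (k : ℤ) →
            a (4 * t) k ≡ ½ *ℚ (a (2 * t) k +ℚ b (2 * t) k)
          × b (4 * t) k ≡ ½ *ℚ (a (2 * t) k +ℚ b (2 * t) k)
          × a (4 * t + 1) k ≡ ½ *ℚ (a (2 * t) k +ℚ b (2 * t) (k - + 1))
          × b (4 * t + 1) k ≡ ½ *ℚ (a (2 * t + 1) k +ℚ b (2 * t + 1) (k +ℤ + 1))
          × a (4 * t + 2) k ≡ ½ *ℚ (a (2 * t + 1) k +ℚ b (2 * t + 1) k)
          × b (4 * t + 2) k ≡ ½ *ℚ (a (2 * t + 1) (k - + 1) +ℚ b (2 * t + 1) (k +ℤ + 1))
          × a (4 * t + 3) k ≡ ½ *ℚ (a (2 * t + 1) (k - + 1) +ℚ b (2 * t + 1) k)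
          × b (4 * t + 3) k ≡ ½ *ℚ (a (2 * t + 2) k +ℚ b (2 * t + 2) (k +ℤ + 1)))
      × a 0 (+ 0) ≡ 1ℚ × b 0 (+ 0) ≡ 1ℚ
      × (∀ (m : ℕ) → a 0 (+ suc m) ≡ 0ℚ × a 0 -[1+ m ] ≡ 0ℚ
                   × b 0 (+ suc m) ≡ 0ℚ × b 0 -[1+ m ] ≡ 0ℚ)
      × a 1 (+ 0) ≡ ½ × a 1 (+ 1) ≡ ½
      × (∀ (m : ℕ) → a 1 (+ (2 + m)) ≡ 0ℚ × a 1 -[1+ m ] ≡ 0ℚ)
      × (∀ (m : ℕ) → b 1 (+ (2 + m)) ≡ 0ℚ)
      × b 1 (+ 1) ≡ ½ *ℚ ½
      × (∀ (m : ℕ) → b 1 (- (+ m)) ≡ threeOver2^ m))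
proposition3p2 =
  (λ t k → let (A-structure , B-structure) = densities-correct t k in
    finiteUnion A-structure , finiteUnion B-structure ,
    Interleaving⇒FiniteUnionOfAPs (C-interleaving t k) (finiteUnion A-structure) (finiteUnion B-structure)) ,
  DensitySequence.a , DensitySequence.b ,
  (λ t k → let (A-structure , B-structure) = densities-correct t k in density A-structure , density B-structure) ,
  (λ t k → a[4t] t k , b[4t] t k , a[4t+1] t k , b[4t+1] t k , a[4t+2] t k , b[4t+2] t k , a[4t+3] t k , b[4t+3] t k) ,
  refl , refl , (λ _ → refl , refl , refl , refl) , refl , refl , (λ _ → refl , refl) , (λ _ → refl) , refl ,
  λ { zero → refl ; (suc _) → refl }
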